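{- Let $M$ be a regular matroid on $E$, let $e,f\in E$ be distinct, let $\vec C$ be a signed circuit, $\vec C^*$ a signed cocircuit and $\vec O$ an orientation of $M$. Suppose $e\in C\cap C^*$, $(\vec C\setminus f)\sim\vec O$ and $(\vec C^*\setminus f)\sim\vec O$. Then $C\cap C^*=\{e,f\}$.
   Context: $M=M(A)$ is represented by a real totally unimodular matrix $A$ of full row rank with columns indexed by $E$ (circuits: minimal sets in no basis; cocircuits: minimal sets meeting every basis). A signed circuit (cocircuit) is an element of $\ker A$ (row space of $A$) with coefficients in $\{ -1,0,1\}$ whose support is a circuit (cocircuit). For a 1-chain $\vec P\in\mathbb Z^E$, $P$ is its support and $\vec P\setminus f$ is the 1-chain obtained by setting the coefficient of $f$ to zero (restricting to $E\setminus\{f\}$). An orientation is a map $\vec O:E\to\{+,-\}$, and $\vec P\sim\vec O$ means that for every $x$ in the support of $\vec P$, the sign of $\vec P(x)$ equals $\vec O(x)$. -}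

module Defs where

open import Data.Nat using (ℕ; zero; suc)
open import Data.Fin using (Fin; zero; suc; punchIn; _≟_)
open import Data.Fin.Subset using (Subset; _∈_; _∉_; _⊆_; _⊂_; _∪_; _∩_; ⁅_⁆; Nonempty; Empty)
open import Data.Integer as ℤ using (ℤ; 0ℤ; 1ℤ; -1ℤ)
open import Data.Rational as ℚ using (ℚ; 0ℚ)
open import Data.Sign using (Sign)
open import Data.Bool using (Bool; not; if_then_else_)
open import Data.Vec using (tabulate)
open import Data.Product using (Σ; ∃; _×_)
open import Data.Sum using (_⊎_)
open import Function.Definitions using (Injective)
open import Relation.Nullary using (¬_; ⌊_⌋)
open import Relation.Binary.PropositionalEquality using (_≡_; _≢_)

-- Real matrices with entries in {-1,0,1}: rows Fin m, columns E = Fin n.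
Matrix : ℕ → ℕ → Set
Matrix m n = Fin m → Fin n → ℤ

toℚ : ℤ → ℚ
toℚ z = z ℚ./ 1

sumℤ : ∀ {k} → (Fin k → ℤ) → ℤ
sumℤ {zero} g = 0ℤ
sumℤ {suc k} g = g zero ℤ.+ sumℤ (λ i → g (suc i))

sumℚ : ∀ {k} → (Fin k → ℚ) → ℚ
sumℚ {zero} g = 0ℚ
sumℚ {suc k} g = g zero ℚ.+ sumℚ (λ i → g (suc i))

alt : ∀ {k} → Fin k → ℤ
alt zero = 1ℤ
alt (suc j) = ℤ.- alt j

det : ∀ {k} → (Fin k → Fin k → ℤ) → ℤ
det {zero} M = 1ℤ
det {suc k} M =
  sumℤ (λ j → alt j ℤ.* M zero j ℤ.* det (λ i j′ → M (suc i) (punchIn j j′)))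

InUnit : ℤ → Set
InUnit z = z ≡ 0ℤ ⊎ (z ≡ 1ℤ ⊎ z ≡ -1ℤ)

TotallyUnimodular : ∀ {m n} → Matrix m n → Set
TotallyUnimodular {m} {n} A =
  ∀ k (r : Fin k → Fin m) (c : Fin k → Fin n) →
  Injective _≡_ _≡_ r → Injective _≡_ _≡_ c →
  InUnit (det (λ i j → A (r i) (c j)))

FullRowRank : ∀ {m n} → Matrix m n → Set
FullRowRank {m} {n} A =
  ∀ (y : Fin m → ℚ) → (∀ j → sumℚ (λ i → y i ℚ.* toℚ (A i j)) ≡ 0ℚ) → ∀ i → y i ≡ 0ℚ

Independent : ∀ {m n} → Matrix m n → Subset n → Set
Independent {m} {n} A S =
  ∀ (c : Fin n → ℚ) → (∀ j → j ∉ S → c j ≡ 0ℚ) →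
  (∀ i → sumℚ (λ j → toℚ (A i j) ℚ.* c j) ≡ 0ℚ) → ∀ j → c j ≡ 0ℚ

IsBasis : ∀ {m n} → Matrix m n → Subset n → Set
IsBasis A B = Independent A B × (∀ x → x ∉ B → ¬ Independent A (B ∪ ⁅ x ⁆))

IsCircuit : ∀ {m n} → Matrix m n → Subset n → Set
IsCircuit A C =
  (∀ B → IsBasis A B → ¬ (C ⊆ B)) ×
  (∀ D → D ⊂ C → ∃ λ B → IsBasis A B × D ⊆ B)

IsCocircuit : ∀ {m n} → Matrix m n → Subset n → Set
IsCocircuit A D =
  (∀ B → IsBasis A B → Nonempty (D ∩ B)) ×
  (∀ D′ → D′ ⊂ D → ∃ λ B → IsBasis A B × Empty (D′ ∩ B))

Chain : ℕ → Set
Chain n = Fin n → ℤ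

support : ∀ {n} → Chain n → Subset n
support v = tabulate (λ x → not ⌊ v x ℤ.≟ 0ℤ ⌋)

Ternary : ∀ {n} → Chain n → Set
Ternary v = ∀ x → InUnit (v x)

InKernel : ∀ {m n} → Matrix m n → Chain n → Set
InKernel A v = ∀ i → sumℤ (λ j → A i j ℤ.* v j) ≡ 0ℤ

InRowSpace : ∀ {m n} → Matrix m n → Chain n → Set
InRowSpace {m} A v =
  Σ (Fin m → ℚ) λ y → ∀ j → sumℚ (λ i → y i ℚ.* toℚ (A i j)) ≡ toℚ (v j)

SignedCircuit : ∀ {m n} → Matrix m n → Chain n → Set
SignedCircuit A v = Ternary v × InKernel A v × IsCircuit A (support v)

SignedCocircuit : ∀ {m n} → Matrix m n → Chain n → Set
SignedCocircuit A v = Ternary v × InRowSpace A v × IsCocircuit A (support v)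

Orientation : ℕ → Set
Orientation n = Fin n → Sign

_∖_ : ∀ {n} → Chain n → Fin n → Chain n
(P ∖ f) x = if ⌊ x ≟ f ⌋ then 0ℤ else P x

_∼_ : ∀ {n} → Chain n → Orientation n → Set
P ∼ O = ∀ x → P x ≢ 0ℤ → ℤ.sign (P x) ≡ O x

-- The signed circuit C lies in ker A and the signed cocircuit C* in the row space of A, so
-- Σₓ C(x)·C*(x) = 0. Away from f both chains agree in sign with O, so every term other than
-- the one at f is nonnegative and the term at e is positive, while the term at f is at least
-- -1. The sum can only vanish if the term at f is -1 and all terms outside {e,f} are 0, i.e.
-- the supports of C and C* meet exactly in {e,f}.
module Submission where

open import Defs
open import Algebra.Bundles using (CommutativeRing)
import Algebra.Properties.Semiring.Sum as SemiringSum
open import Data.Bool using (true; not)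
open import Data.Fin using (Fin; zero; suc; _≟_)
open import Data.Fin.Properties using (punchInᵢ≢i)
open import Data.Fin.Subset using (_∈_; _⊆_; _∩_; _∪_; ⁅_⁆)
open import Data.Fin.Subset.Properties
  using (⊆-antisym; x∈p∩q⁺; x∈p∩q⁻; p⊆p∪q; q⊆p∪q; x∈p∪q⁻; x∈⁅x⁆; x∈⁅y⁆⇒x≡y)
open import Data.Integer as ℤ using (ℤ; +_; -[1+_]; +[1+_]; 0ℤ; 1ℤ; -1ℤ; +≤+; -≤-; -≤+)
import Data.Integer.Properties as ℤP
open import Data.Nat using (zero; suc; z≤n; s≤s)
import Data.Nat.Properties as ℕP
open import Data.Product using (_,_; _×_; proj₁; proj₂)
open import Data.Rational as ℚ using (ℚ; 0ℚ; toℚᵘ)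
import Data.Rational.Properties as ℚP
open import Data.Rational.Unnormalised as ℚᵘ using (mkℚᵘ; *≡*) renaming (_≃_ to _≃ᵘ_)
import Data.Rational.Unnormalised.Properties as ℚᵘP
open import Data.Sign using (Sign)
open import Data.Sum using (inj₁; inj₂; [_,_]′)
open import Data.Vec using (lookup)
open import Data.Vec.Properties using (lookup∘tabulate; []=⇒lookup; lookup⇒[]=)
open import Data.Vec.Functional using (removeAt)
open import Function using (_∘_; _$_)
open import Relation.Nullary using (yes; no; contradiction; ⌊_⌋)
open import Relation.Nullary.Decidable using (isYes≗does; dec-false)
open import Relation.Binary.PropositionalEquality

toℚᵘ-toℚ : ∀ z → toℚᵘ (toℚ z) ≃ᵘ mkℚᵘ z 0
toℚᵘ-toℚ z = ℚP.toℚᵘ-fromℚᵘ (mkℚᵘ z 0)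

toℚ-+ : ∀ a b → toℚ (a ℤ.+ b) ≡ toℚ a ℚ.+ toℚ b
toℚ-+ a b = ℚP.toℚᵘ-injective $ begin
  toℚᵘ (toℚ (a ℤ.+ b))           ≈⟨ toℚᵘ-toℚ (a ℤ.+ b) ⟩
  mkℚᵘ (a ℤ.+ b) 0               ≈⟨ *≡* (cong (ℤ._* 1ℤ) (cong₂ ℤ._+_ (ℤP.*-identityʳ a) (ℤP.*-identityʳ b))) ⟨
  mkℚᵘ a 0 ℚᵘ.+ mkℚᵘ b 0         ≈⟨ ℚᵘP.+-cong (toℚᵘ-toℚ a) (toℚᵘ-toℚ b) ⟨
  toℚᵘ (toℚ a) ℚᵘ.+ toℚᵘ (toℚ b) ≈⟨ ℚP.toℚᵘ-homo-+ (toℚ a) (toℚ b) ⟨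
  toℚᵘ (toℚ a ℚ.+ toℚ b)         ∎
  where open ℚᵘP.≃-Reasoning

toℚ-* : ∀ a b → toℚ (a ℤ.* b) ≡ toℚ a ℚ.* toℚ b
toℚ-* a b = ℚP.toℚᵘ-injective $ begin
  toℚᵘ (toℚ (a ℤ.* b))           ≈⟨ toℚᵘ-toℚ (a ℤ.* b) ⟩
  mkℚᵘ a 0 ℚᵘ.* mkℚᵘ b 0         ≈⟨ ℚᵘP.*-cong (toℚᵘ-toℚ a) (toℚᵘ-toℚ b) ⟨
  toℚᵘ (toℚ a) ℚᵘ.* toℚᵘ (toℚ b) ≈⟨ ℚP.toℚᵘ-homo-* (toℚ a) (toℚ b) ⟨
  toℚᵘ (toℚ a ℚ.* toℚ b)         ∎
  where open ℚᵘP.≃-Reasoning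

toℚ-injective : ∀ {a b} → toℚ a ≡ toℚ b → a ≡ b
toℚ-injective {a} {b} toℚa≡toℚb
  with ℚᵘP.≃-trans (ℚᵘP.≃-sym (toℚᵘ-toℚ a)) (ℚᵘP.≃-trans (ℚP.toℚᵘ-cong toℚa≡toℚb) (toℚᵘ-toℚ b))
... | *≡* a*1≡b*1 = trans (sym (ℤP.*-identityʳ a)) (trans a*1≡b*1 (ℤP.*-identityʳ b))

module ℚΣ = SemiringSum (CommutativeRing.semiring ℚP.+-*-commutativeRing)
module ℤΣ = SemiringSum ℤP.+-*-semiring

sumℚ≡sum : ∀ {k} (g : Fin k → ℚ) → sumℚ g ≡ ℚΣ.sum g
sumℚ≡sum {zero}  g = refl
sumℚ≡sum {suc k} g = cong (g zero ℚ.+_) (sumℚ≡sum (g ∘ suc))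

sumℤ≡sum : ∀ {k} (g : Fin k → ℤ) → sumℤ g ≡ ℤΣ.sum g
sumℤ≡sum {zero}  g = refl
sumℤ≡sum {suc k} g = cong (ℤ._+_ (g zero)) (sumℤ≡sum (g ∘ suc))

toℚ-sumℤ : ∀ {k} (g : Fin k → ℤ) → toℚ (sumℤ g) ≡ sumℚ (toℚ ∘ g)
toℚ-sumℤ {zero}  g = refl
toℚ-sumℤ {suc k} g = trans (toℚ-+ (g zero) _) (cong (toℚ (g zero) ℚ.+_) (toℚ-sumℤ (g ∘ suc)))

toℚ-sumℤ-* : ∀ {k} (a b : Fin k → ℤ) →
             toℚ (sumℤ (λ j → a j ℤ.* b j)) ≡ ℚΣ.sum (λ j → toℚ (a j) ℚ.* toℚ (b j))
toℚ-sumℤ-* a b = begin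
  toℚ (sumℤ (λ j → a j ℤ.* b j))           ≡⟨ toℚ-sumℤ (λ j → a j ℤ.* b j) ⟩
  sumℚ (λ j → toℚ (a j ℤ.* b j))           ≡⟨ sumℚ≡sum (λ j → toℚ (a j ℤ.* b j)) ⟩
  ℚΣ.sum (λ j → toℚ (a j ℤ.* b j))         ≡⟨ ℚΣ.sum-cong-≗ (λ j → toℚ-* (a j) (b j)) ⟩
  ℚΣ.sum (λ j → toℚ (a j) ℚ.* toℚ (b j))   ∎
  where open ≡-Reasoning

_·_ : ∀ {n} → Chain n → Chain n → Chain n
(u · v) x = u x ℤ.* v x

kernel⊥rowSpace : ∀ {m n} (A : Matrix m n) {u v : Chain n} →
                  InKernel A u → InRowSpace A v → sumℤ (u · v) ≡ 0ℤ
kernel⊥rowSpace {m} {n} A {u} {v} Au≡0 (y , yA≡v) = toℚ-injective $ begin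
  toℚ (sumℤ (u · v))
    ≡⟨ toℚ-sumℤ-* u v ⟩
  ∑[ j < n ] (û j ℚ.* toℚ (v j))
    ≡⟨ ℚΣ.sum-cong-≗ (λ j → cong (û j ℚ.*_) (yA j)) ⟨
  ∑[ j < n ] (û j ℚ.* ∑[ i < m ] (y i ℚ.* a i j))
    ≡⟨ ℚΣ.sum-cong-≗ (λ j → ℚΣ.*-distribˡ-sum (û j) (λ i → y i ℚ.* a i j)) ⟩
  ∑[ j < n ] ∑[ i < m ] (û j ℚ.* (y i ℚ.* a i j))
    ≡⟨ ℚΣ.sum-cong-≗ (λ j → ℚΣ.sum-cong-≗ (λ i → rotate (û j) (y i) (a i j))) ⟩
  ∑[ j < n ] ∑[ i < m ] (y i ℚ.* (a i j ℚ.* û j))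
    ≡⟨ ℚΣ.∑-comm (λ j i → y i ℚ.* (a i j ℚ.* û j)) ⟩
  ∑[ i < m ] ∑[ j < n ] (y i ℚ.* (a i j ℚ.* û j))
    ≡⟨ ℚΣ.sum-cong-≗ (λ i → ℚΣ.*-distribˡ-sum (y i) (λ j → a i j ℚ.* û j)) ⟨
  ∑[ i < m ] (y i ℚ.* ∑[ j < n ] (a i j ℚ.* û j))
    ≡⟨ ℚΣ.sum-cong-≗ (λ i → trans (cong (y i ℚ.*_) (Au i)) (ℚP.*-zeroʳ (y i))) ⟩
  ∑[ i < m ] 0ℚ
    ≡⟨ ℚΣ.sum-replicate-zero m ⟩
  0ℚ
    ∎
  where
  open ≡-Reasoning
  open ℚΣ using (sum-syntax)
  a : Fin m → Fin n → ℚ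
  a i j = toℚ (A i j)
  û : Fin n → ℚ
  û = toℚ ∘ u
  yA : ∀ j → ∑[ i < m ] (y i ℚ.* a i j) ≡ toℚ (v j)
  yA j = trans (sym (sumℚ≡sum (λ i → y i ℚ.* a i j))) (yA≡v j)
  Au : ∀ i → ∑[ j < n ] (a i j ℚ.* û j) ≡ 0ℚ
  Au i = trans (sym (toℚ-sumℤ-* (A i) u)) (cong toℚ (Au≡0 i))
  rotate : ∀ p q r → p ℚ.* (q ℚ.* r) ≡ q ℚ.* (r ℚ.* p)
  rotate p q r = trans (ℚP.*-comm p _) (ℚP.*-assoc q r p)

∈-support⁻ : ∀ {n} {v : Chain n} {x} → x ∈ support v → v x ≢ 0ℤ
∈-support⁻ {v = v} {x} x∈v
  with v x ℤ.≟ 0ℤ | trans (sym (lookup∘tabulate (λ y → not ⌊ v y ℤ.≟ 0ℤ ⌋) x)) ([]=⇒lookup x∈v)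
... | yes _    | ()
... | no vx≢0  | _ = vx≢0

∈-support⁺ : ∀ {n} {v : Chain n} {x} → v x ≢ 0ℤ → x ∈ support v
∈-support⁺ {v = v} {x} vx≢0 = lookup⇒[]= x (support v) $ begin
  lookup (support v) x      ≡⟨ lookup∘tabulate _ x ⟩
  not ⌊ v x ℤ.≟ 0ℤ ⌋        ≡⟨ cong not (trans (isYes≗does (v x ℤ.≟ 0ℤ)) (dec-false (v x ℤ.≟ 0ℤ) vx≢0)) ⟩
  true                      ∎
  where open ≡-Reasoning

support-· : ∀ {n} (u v : Chain n) → support (u · v) ≡ support u ∩ support v
support-· u v = ⊆-antisym ⊆∩ ∩⊆
  where
  ⊆∩ : support (u · v) ⊆ support u ∩ support v
  ⊆∩ {x} x∈uv = x∈p∩q⁺ (∈-support⁺ ux≢0 , ∈-support⁺ vx≢0)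
    where
    uxvx≢0 : u x ℤ.* v x ≢ 0ℤ
    uxvx≢0 = ∈-support⁻ x∈uv
    ux≢0 : u x ≢ 0ℤ
    ux≢0 ux≡0 = uxvx≢0 (trans (cong (ℤ._* v x) ux≡0) (ℤP.*-zeroˡ (v x)))
    vx≢0 : v x ≢ 0ℤ
    vx≢0 vx≡0 = uxvx≢0 (trans (cong (u x ℤ.*_) vx≡0) (ℤP.*-zeroʳ (u x)))
  ∩⊆ : support u ∩ support v ⊆ support (u · v)
  ∩⊆ {x} x∈u∩v with x∈p∩q⁻ (support u) (support v) x∈u∩v
  ... | x∈u , x∈v = ∈-support⁺ λ uxvx≡0 →
    [ ∈-support⁻ x∈u , ∈-support⁻ x∈v ]′ (ℤP.i*j≡0⇒i≡0∨j≡0 (u x) uxvx≡0)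

∖-self : ∀ {n} (P : Chain n) a → (P ∖ a) a ≡ 0ℤ
∖-self P a with a ≟ a
... | yes _   = refl
... | no a≢a  = contradiction refl a≢a

∖-other : ∀ {n} (P : Chain n) {a x} → x ≢ a → (P ∖ a) x ≡ P x
∖-other P {a} {x} x≢a with x ≟ a
... | yes x≡a = contradiction x≡a x≢a
... | no _    = refl

∖-nonneg : ∀ {n} {P : Chain n} {a} → (∀ x → x ≢ a → 0ℤ ℤ.≤ P x) → ∀ x → 0ℤ ℤ.≤ (P ∖ a) x
∖-nonneg {a = a} 0≤P x with x ≟ a
... | yes _   = ℤP.≤-refl
... | no x≢a  = 0≤P x x≢a

sumℤ-∖ : ∀ {n} (g : Chain n) a → sumℤ g ≡ g a ℤ.+ sumℤ (g ∖ a)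
sumℤ-∖ {suc n} g a = begin
  sumℤ g                                 ≡⟨ sumℤ≡sum g ⟩
  ℤΣ.sum g                               ≡⟨ ℤΣ.sum-remove {i = a} g ⟩
  g a ℤ.+ ℤΣ.sum (removeAt g a)          ≡⟨ cong (ℤ._+_ (g a)) removal ⟩
  g a ℤ.+ sumℤ (g ∖ a)                   ∎
  where
  open ≡-Reasoning
  removal : ℤΣ.sum (removeAt g a) ≡ sumℤ (g ∖ a)
  removal = begin
    ℤΣ.sum (removeAt g a)                        ≡⟨ ℤΣ.sum-cong-≗ (λ i → ∖-other g (punchInᵢ≢i a i)) ⟨
    ℤΣ.sum (removeAt (g ∖ a) a)                  ≡⟨ ℤP.+-identityˡ _ ⟨
    0ℤ ℤ.+ ℤΣ.sum (removeAt (g ∖ a) a)           ≡⟨ cong (ℤ._+ ℤΣ.sum (removeAt (g ∖ a) a)) (∖-self g a) ⟨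
    (g ∖ a) a ℤ.+ ℤΣ.sum (removeAt (g ∖ a) a)    ≡⟨ ℤΣ.sum-remove {i = a} (g ∖ a) ⟨
    ℤΣ.sum (g ∖ a)                               ≡⟨ sumℤ≡sum (g ∖ a) ⟨
    sumℤ (g ∖ a)                                 ∎

sumℤ-nonneg : ∀ {k} (g : Fin k → ℤ) → (∀ i → 0ℤ ℤ.≤ g i) → 0ℤ ℤ.≤ sumℤ g
sumℤ-nonneg {zero}  g 0≤g = ℤP.≤-refl
sumℤ-nonneg {suc k} g 0≤g = ℤP.+-mono-≤ (0≤g zero) (sumℤ-nonneg (g ∘ suc) (0≤g ∘ suc))

nonneg+nonneg≡0⇒≡0ˡ : ∀ {i j} → 0ℤ ℤ.≤ i → 0ℤ ℤ.≤ j → i ℤ.+ j ≡ 0ℤ → i ≡ 0ℤ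
nonneg+nonneg≡0⇒≡0ˡ (+≤+ _) (+≤+ _) i+j≡0 = cong +_ (ℕP.m+n≡0⇒m≡0 _ (ℤP.+-injective i+j≡0))

nonneg-sumℤ≡0⇒≡0 : ∀ {n} (g : Chain n) → (∀ i → 0ℤ ℤ.≤ g i) → sumℤ g ≡ 0ℤ → ∀ i → g i ≡ 0ℤ
nonneg-sumℤ≡0⇒≡0 g 0≤g Σg≡0 i =
  nonneg+nonneg≡0⇒≡0ˡ (0≤g i) (sumℤ-nonneg (g ∖ i) (∖-nonneg (λ x _ → 0≤g x))) (trans (sym (sumℤ-∖ g i)) Σg≡0)

nonneg∧≢0⇒≥1 : ∀ {i} → 0ℤ ℤ.≤ i → i ≢ 0ℤ → 1ℤ ℤ.≤ i
nonneg∧≢0⇒≥1 {+ zero}  _ i≢0 = contradiction refl i≢0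
nonneg∧≢0⇒≥1 {+ suc _} _ _   = +≤+ (s≤s z≤n)

i+[j+k]≡0⇒i≡-1∧k≡0 : ∀ {i j k} → -1ℤ ℤ.≤ i → 1ℤ ℤ.≤ j → 0ℤ ℤ.≤ k →
                     i ℤ.+ (j ℤ.+ k) ≡ 0ℤ → i ≡ -1ℤ × k ≡ 0ℤ
i+[j+k]≡0⇒i≡-1∧k≡0 (-≤- z≤n) (+≤+ (s≤s z≤n)) (+≤+ z≤n) eq =
  refl , cong +_ (ℕP.m+n≡0⇒n≡0 _ (ℤP.+-injective eq))
i+[j+k]≡0⇒i≡-1∧k≡0 {+ a} -≤+ (+≤+ (s≤s z≤n)) (+≤+ z≤n) eq
  with () ← ℕP.m+n≡0⇒n≡0 a (ℤP.+-injective eq)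

zero-sum-profile : ∀ {n} (p : Chain n) {e f} → e ≢ f → sumℤ p ≡ 0ℤ →
                   (∀ x → x ≢ f → 0ℤ ℤ.≤ p x) → -1ℤ ℤ.≤ p f → p e ≢ 0ℤ →
                   p f ≡ -1ℤ × (∀ x → x ≢ e → x ≢ f → p x ≡ 0ℤ)
zero-sum-profile p {e} {f} e≢f Σp≡0 0≤p -1≤pf pe≢0 = proj₁ balance , vanishes
  where
  open ≡-Reasoning
  q : Chain _
  q = (p ∖ f) ∖ e
  0≤q : ∀ x → 0ℤ ℤ.≤ q x
  0≤q = ∖-nonneg (λ x _ → ∖-nonneg 0≤p x)
  decomposition : p f ℤ.+ (p e ℤ.+ sumℤ q) ≡ 0ℤ
  decomposition = begin
    p f ℤ.+ (p e ℤ.+ sumℤ q)         ≡⟨ cong (λ z → p f ℤ.+ (z ℤ.+ sumℤ q)) (∖-other p e≢f) ⟨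
    p f ℤ.+ ((p ∖ f) e ℤ.+ sumℤ q)   ≡⟨ cong (ℤ._+_ (p f)) (sumℤ-∖ (p ∖ f) e) ⟨
    p f ℤ.+ sumℤ (p ∖ f)             ≡⟨ sumℤ-∖ p f ⟨
    sumℤ p                           ≡⟨ Σp≡0 ⟩
    0ℤ                               ∎
  balance : p f ≡ -1ℤ × sumℤ q ≡ 0ℤ
  balance = i+[j+k]≡0⇒i≡-1∧k≡0 -1≤pf (nonneg∧≢0⇒≥1 (0≤p e e≢f) pe≢0) (sumℤ-nonneg q 0≤q) decomposition
  vanishes : ∀ x → x ≢ e → x ≢ f → p x ≡ 0ℤ
  vanishes x x≢e x≢f = begin
    p x          ≡⟨ ∖-other p x≢f ⟨
    (p ∖ f) x    ≡⟨ ∖-other (p ∖ f) x≢e ⟨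
    q x          ≡⟨ nonneg-sumℤ≡0⇒≡0 q 0≤q (proj₂ balance) x ⟩
    0ℤ           ∎

support≡⁅⁆∪⁅⁆ : ∀ {n} (p : Chain n) {e f} → p e ≢ 0ℤ → p f ≢ 0ℤ →
                (∀ x → x ≢ e → x ≢ f → p x ≡ 0ℤ) → support p ≡ ⁅ e ⁆ ∪ ⁅ f ⁆
support≡⁅⁆∪⁅⁆ p {e} {f} pe≢0 pf≢0 vanishes = ⊆-antisym ⊆pair pair⊆
  where
  ⊆pair : support p ⊆ ⁅ e ⁆ ∪ ⁅ f ⁆
  ⊆pair {x} x∈p with x ≟ e | x ≟ f
  ... | yes refl | _        = p⊆p∪q ⁅ f ⁆ (x∈⁅x⁆ e)
  ... | no _     | yes refl = q⊆p∪q ⁅ e ⁆ ⁅ f ⁆ (x∈⁅x⁆ f)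
  ... | no x≢e   | no x≢f   = contradiction (vanishes x x≢e x≢f) (∈-support⁻ x∈p)
  pair⊆ : ⁅ e ⁆ ∪ ⁅ f ⁆ ⊆ support p
  pair⊆ {x} x∈pair with x∈p∪q⁻ ⁅ e ⁆ ⁅ f ⁆ x∈pair
  ... | inj₁ x∈⁅e⁆ = subst (_∈ support p) (sym (x∈⁅y⁆⇒x≡y e x∈⁅e⁆)) (∈-support⁺ pe≢0)
  ... | inj₂ x∈⁅f⁆ = subst (_∈ support p) (sym (x∈⁅y⁆⇒x≡y f x∈⁅f⁆)) (∈-support⁺ pf≢0)

same-sign⇒0≤* : ∀ {c d : ℤ} {o : Sign} →
                (c ≢ 0ℤ → ℤ.sign c ≡ o) → (d ≢ 0ℤ → ℤ.sign d ≡ o) → 0ℤ ℤ.≤ c ℤ.* d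
same-sign⇒0≤* {+ zero}                 _   _   = +≤+ z≤n
same-sign⇒0≤* {c}         {+ zero}    _   _   = ℤP.≤-reflexive (sym (ℤP.*-zeroʳ c))
same-sign⇒0≤* {+[1+ _ ]}  {+[1+ _ ]}  _   _   = +≤+ z≤n
same-sign⇒0≤* { -[1+ _ ]} { -[1+ _ ]} _   _   = +≤+ z≤n
same-sign⇒0≤* {+[1+ _ ]}  { -[1+ _ ]} c∼o d∼o with () ← trans (c∼o λ ()) (sym (d∼o λ ()))
same-sign⇒0≤* { -[1+ _ ]} {+[1+ _ ]}  c∼o d∼o with () ← trans (c∼o λ ()) (sym (d∼o λ ()))

InUnit-* : ∀ {c d} → InUnit c → InUnit d → InUnit (c ℤ.* d)
InUnit-* (inj₁ refl)        _                  = inj₁ refl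
InUnit-* {c} (inj₂ _)       (inj₁ refl)        = inj₁ (ℤP.*-zeroʳ c)
InUnit-* (inj₂ (inj₁ refl)) (inj₂ (inj₁ refl)) = inj₂ (inj₁ refl)
InUnit-* (inj₂ (inj₁ refl)) (inj₂ (inj₂ refl)) = inj₂ (inj₂ refl)
InUnit-* (inj₂ (inj₂ refl)) (inj₂ (inj₁ refl)) = inj₂ (inj₂ refl)
InUnit-* (inj₂ (inj₂ refl)) (inj₂ (inj₂ refl)) = inj₂ (inj₁ refl)

InUnit⇒≥-1 : ∀ {z} → InUnit z → -1ℤ ℤ.≤ z
InUnit⇒≥-1 (inj₁ refl)        = -≤+
InUnit⇒≥-1 (inj₂ (inj₁ refl)) = -≤+
InUnit⇒≥-1 (inj₂ (inj₂ refl)) = ℤP.≤-refl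

∖-∼⇒sign≡ : ∀ {n} (P : Chain n) {f} {O : Orientation n} → (P ∖ f) ∼ O →
            ∀ {x} → x ≢ f → P x ≢ 0ℤ → ℤ.sign (P x) ≡ O x
∖-∼⇒sign≡ P {O = O} P∖f∼O {x} x≢f = subst (λ z → z ≢ 0ℤ → ℤ.sign z ≡ O x) (∖-other P x≢f) (P∖f∼O x)

lemma3p3 : ∀ {m n} (A : Matrix m n) → TotallyUnimodular A → FullRowRank A →
           (e f : Fin n) → e ≢ f →
           (C C* : Chain n) → SignedCircuit A C → SignedCocircuit A C* →
           (O : Orientation n) →
           e ∈ (support C ∩ support C*) →
           (C ∖ f) ∼ O → (C* ∖ f) ∼ O →
           support C ∩ support C* ≡ ⁅ e ⁆ ∪ ⁅ f ⁆
lemma3p3 A _ _ e f e≢f C C* (C-unit , C∈ker , _) (C*-unit , C*∈row , _) O e∈C∩C* C∖f∼O C*∖f∼O =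
  begin
    support C ∩ support C*  ≡⟨ support-· C C* ⟨
    support (C · C*)        ≡⟨ support≡⁅⁆∪⁅⁆ (C · C*) Ce·C*e≢0 Cf·C*f≢0 (proj₂ profile) ⟩
    ⁅ e ⁆ ∪ ⁅ f ⁆           ∎
  where
  open ≡-Reasoning
  Ce·C*e≢0 : C e ℤ.* C* e ≢ 0ℤ
  Ce·C*e≢0 = ∈-support⁻ (subst (e ∈_) (sym (support-· C C*)) e∈C∩C*)
  profile : C f ℤ.* C* f ≡ -1ℤ × (∀ x → x ≢ e → x ≢ f → C x ℤ.* C* x ≡ 0ℤ)
  profile = zero-sum-profile (C · C*) e≢f (kernel⊥rowSpace A C∈ker C*∈row)
    (λ x x≢f → same-sign⇒0≤* (∖-∼⇒sign≡ C C∖f∼O x≢f) (∖-∼⇒sign≡ C* C*∖f∼O x≢f))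
    (InUnit⇒≥-1 (InUnit-* (C-unit f) (C*-unit f)))
    Ce·C*e≢0
  Cf·C*f≢0 : C f ℤ.* C* f ≢ 0ℤ
  Cf·C*f≢0 = subst (_≢ 0ℤ) (sym (proj₁ profile)) λ ()
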